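{- Let $p$ be a prime and $m \in \mathbb{F}_p \setminus \{ -1\}$. Then for every $d\ge1$ the black and white image $I^d$ of $M_d$ is the $d$-th step in the construction of a non-trivial self-similar set $I = \lim_d I^d$; that is, there is a $p\times p$ $\{0,1\}$-matrix $D$ with at least one $0$ and at least two $1$'s such that $I^d$ is the black and white image of $D^{\otimes d}$ for all $d \ge 1$. For $m = -1$, the set $I$ is the full square $[0,1]\times[0,1]$.
   Context: For $m\in\mathbb{F}_p$ and $d \ge 1$, $M_d = (a_{i,j})_{0 \le i,j \le p^d-1}$ is the $p^d\times p^d$ matrix over $\mathbb{F}_p$ with $a_{i,0} = a_{0,j} = 1$ and $a_{i,j} = a_{i-1,j} + m\, a_{i-1,j-1} + a_{i,j-1}$ for $i,j\ge1$. The black and white image of an $N\times N$ matrix $(b_{i,j})$ is the subset of $[0,1]\times[0,1]$ obtained by tiling the square into $N\times N$ equal closed squares $S_{i,j}$ and removing the interior of $S_{i,j}$ exactly when $b_{i,j}=0$; $I^d$ is the image of $M_d$ and $I = \lim I^d$ in the Hausdorff metric. $A\otimes B$ denotes the block matrix $(a_{i,j}B)$ for $A=(a_{i,j})$; $D^{\otimes1}=D$, $D^{\otimes(d+1)} = D^{\otimes d}\otimes D$. For a $\{0,1\}$-matrix $D$ with at least one zero and two ones, the images of $D^{\otimes d}$ are the successive steps of the standard substitution construction of a non-trivial self-similar set. -}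

module Defs where

open import Data.Nat using (ℕ; zero; suc; _+_; _*_; _/_; _%_; NonZero)
open import Data.Nat.DivMod using (_mod_)
open import Data.Fin using (Fin)
open import Data.Bool using (Bool; true; _∧_)

-- Elements of 𝔽_p are represented by residues in ℕ (values < p),
-- all arithmetic reduced modulo p.

module _ (p : ℕ) .{{_ : NonZero p}} (m : ℕ) where

  -- entryM i j = a_{i,j}, the (i,j) entry of M_d (for i, j < p^d);
  -- a_{i,0} = a_{0,j} = 1,  a_{i,j} = a_{i-1,j} + m a_{i-1,j-1} + a_{i,j-1}  in 𝔽_p.
  -- (The entries do not depend on d: M_d is the top-left p^d × p^d corner.)
  entryM : ℕ → ℕ → ℕ
  entryM zero    j       = 1 % p
  entryM (suc i) zero    = 1 % p
  entryM (suc i) (suc j) = (entryM i (suc j) + m * entryM i j + entryM (suc i) j) % p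

module _ (p : ℕ) .{{_ : NonZero p}} where

  BinMat : Set
  BinMat = Fin p → Fin p → Bool

  -- Entry (i,j) of the Kronecker power D^{⊗d} (a p^d × p^d matrix, i, j < p^d),
  -- using D^{⊗(d+1)} = D^{⊗d} ⊗ D, so entry (i,j) = D^{⊗d}(i/p, j/p) · D(i mod p, j mod p).
  -- D^{⊗0} is the 1×1 matrix (1), so D^{⊗1} = D.
  kronPow : BinMat → ℕ → ℕ → ℕ → Bool
  kronPow D zero    i j = true
  kronPow D (suc d) i j = kronPow D d (i / p) (j / p) ∧ D (i mod p) (j mod p)

{-# OPTIONS --safe #-}
-- The entries of M_d are the reductions mod p of the integers
-- E i j = Σₖ C(i,k) C(j,k) (m+1)ᵏ, which satisfy the same recurrence.  As p ∣ C(p,k)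
-- for 0 < k < p, this closed form and Fermat's little theorem give E p s ≡ 1 for s < p
-- and E p p ≡ m + 2, i.e. E (p-1) (s+1) + m E (p-1) s ≡ 0 and m E (p-1) (p-1) ≡ m.
-- These boundary values turn the recurrence into the Lucas-type factorisation
-- E (r + i p) (s + j p) ≡ E r s · E i j  (r, s < p).  Since p is prime, E x y ≢ 0 exactly
-- when both factors are nonzero, so the zero pattern of M_d is the d-th Kronecker power of
-- the zero pattern of M_1.  That pattern has a zero in row 1 because E 1 j = 1 + j (m+1)
-- vanishes for some j once m + 1 is invertible; for m = -1 every entry equals 1.
module Submission where

open import Data.Nat
  using (ℕ; zero; suc; _+_; _*_; _^_; _∸_; _<_; _≤_; _≥_; _%_; _/_; _!; _≡ᵇ_; NonZero; pred; s≤s; z<s; s<s; nonTrivial⇒n>1)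
open import Data.Nat.Properties
  using ( +-*-semiring; +-*-commutativeSemiring; +-comm; *-comm; *-assoc; +-identityʳ; *-identityˡ; *-identityʳ
        ; *-zeroʳ; ^-zeroˡ; +-cancelʳ-≡; suc-pred; n<1+n; <-trans; <⇒≤; <⇒≱; ≤∧≢⇒<; m≤n⇒m≤1+n; m∸n≤m; _!*_!≢0)
open import Data.Nat.DivMod
  using ( _mod_; %-distribˡ-+; %-distribˡ-*; m%n%n≡m%n; [m+n]%n≡m%n; [m+kn]%n≡m%n; m*n%n≡0; m<n⇒m%n≡m
        ; m%n<n; m≡m%n+[m/n]*n; m/n*n≡m; m<n*o⇒m/o<n)
open import Data.Nat.Divisibility using (_∣_; ∣-refl; m∣m*n; n∣m*n; ∣m⇒∣m*n; ∣⇒≤; ∣1⇒≡1; n∣m⇒m%n≡0; m%n≡0⇒n∣m)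
open import Data.Nat.Primality using (Prime; euclidsLemma; ¬prime[0]; ¬prime[1]; prime⇒nonZero; prime⇒nonTrivial)
open import Data.Nat.Coprimality using (prime⇒coprime; coprime-Bézout)
open import Data.Nat.GCD using (module Bézout)
open import Data.Nat.Combinatorics using (_C_; nCn≡1; k>n⇒nCk≡0; nCk+nC[k+1]≡[n+1]C[k+1]; nCk≡n!/k![n-k]!; k![n∸k]!∣n!)
open import Data.Nat.Tactic.RingSolver using (solve-∀)
open import Data.Fin using (Fin; toℕ; fromℕ; fromℕ<; inject₁)
open import Data.Fin.Patterns using (0F; 1F)
open import Data.Fin.Properties using (toℕ-fromℕ; toℕ-fromℕ<; toℕ-inject₁; toℕ<n)
open import Data.Vec.Functional using (init; last)
open import Data.Bool using (Bool; true; false; not; _∧_)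
open import Data.Bool.Properties using (∧-comm)
open import Data.Product using (Σ; ∃; _×_; _,_)
open import Data.Sum using ([_,_]′)
open import Data.Empty using (⊥-elim)
open import Function using (id; _∘_; case_of_)
open import Function.Bundles using (_⇔_; mk⇔)
open import Relation.Binary using (Setoid)
import Relation.Binary.Reasoning.Setoid as SetoidReasoning
open import Relation.Binary.PropositionalEquality using (_≡_; _≢_; refl; sym; trans; cong; cong₂; subst; module ≡-Reasoning)
open import Relation.Nullary using (¬_; contradiction)
open import Algebra.Properties.Semiring.Sum +-*-semiring
  using (sum; sum-syntax; sum-init-last; sum-cong-≗; sum-replicate-zero; ∑-distrib-+; *-distribˡ-sum)
open import Algebra.Properties.Semiring.Exp +-*-semiring using () renaming (_^_ to _^ₛ_)
open import Algebra.Properties.Semiring.Mult +-*-semiring using () renaming (_×_ to _×ₘ_)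
import Algebra.Properties.CommutativeSemiring.Binomial +-*-commutativeSemiring as Binomial

open import Defs

∑< : ℕ → (ℕ → ℕ) → ℕ
∑< N f = ∑[ k < N ] f (toℕ k)

∑<-+ : ∀ N (f g : ℕ → ℕ) → ∑< N (λ k → f k + g k) ≡ ∑< N f + ∑< N g
∑<-+ N f g = ∑-distrib-+ {N} (f ∘ toℕ) (g ∘ toℕ)

∑<-* : ∀ N a (f : ℕ → ℕ) → ∑< N (λ k → a * f k) ≡ a * ∑< N f
∑<-* N a f = sym (*-distribˡ-sum {N} a (f ∘ toℕ))

∑<-drop-last : ∀ N (f : ℕ → ℕ) → f N ≡ 0 → ∑< (suc N) f ≡ ∑< N f
∑<-drop-last N f fN≡0 = begin
  ∑< (suc N) f                                       ≡⟨ sum-init-last (f ∘ toℕ) ⟩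
  ∑[ k < N ] f (toℕ (inject₁ k)) + f (toℕ (fromℕ N)) ≡⟨ cong₂ _+_ (sum-cong-≗ {N} (cong f ∘ toℕ-inject₁))
                                                                  (trans (cong f (toℕ-fromℕ N)) fN≡0) ⟩
  ∑< N f + 0                                         ≡⟨ +-identityʳ (∑< N f) ⟩
  ∑< N f                                             ∎
  where open ≡-Reasoning

∑<-linear : ∀ N a (f g h e : ℕ → ℕ) →
            ∑< N (λ k → f k + a * g k + h k + e k) ≡ ∑< N f + a * ∑< N g + ∑< N h + ∑< N e
∑<-linear N a f g h e = begin
  ∑< N (λ k → f k + a * g k + h k + e k)          ≡⟨ ∑<-+ N (λ k → f k + a * g k + h k) e ⟩
  ∑< N (λ k → f k + a * g k + h k) + ∑< N e        ≡⟨ cong (_+ ∑< N e) (∑<-+ N (λ k → f k + a * g k) h) ⟩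
  ∑< N (λ k → f k + a * g k) + ∑< N h + ∑< N e     ≡⟨ cong (λ x → x + ∑< N h + ∑< N e) (∑<-+ N f (λ k → a * g k)) ⟩
  ∑< N f + ∑< N (λ k → a * g k) + ∑< N h + ∑< N e  ≡⟨ cong (λ x → ∑< N f + x + ∑< N h + ∑< N e) (∑<-* N a g) ⟩
  ∑< N f + a * ∑< N g + ∑< N h + ∑< N e            ∎
  where open ≡-Reasoning

module Congruence (n : ℕ) .{{_ : NonZero n}} where

  infix 4 _≈_
  record _≈_ (a b : ℕ) : Set where
    constructor mk≈
    field
      %-≡ : a % n ≡ b % n

  open _≈_ public

  ≈-setoid : Setoid _ _
  ≈-setoid = record
    { _≈_           = _≈_
    ; isEquivalence = record
      { refl  = mk≈ refl
      ; sym   = λ a≈b → mk≈ (sym (%-≡ a≈b))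
      ; trans = λ a≈b b≈c → mk≈ (trans (%-≡ a≈b) (%-≡ b≈c))
      }
    }

  open Setoid ≈-setoid public using () renaming (refl to ≈-refl; sym to ≈-sym; trans to ≈-trans)
  module ≈-Reasoning = SetoidReasoning ≈-setoid

  ≡⇒≈ : ∀ {a b} → a ≡ b → a ≈ b
  ≡⇒≈ refl = ≈-refl

  +-cong : ∀ {a b c d} → a ≈ b → c ≈ d → a + c ≈ b + d
  +-cong {a} {b} {c} {d} (mk≈ a≈b) (mk≈ c≈d) = mk≈ (begin
    (a + c) % n              ≡⟨ %-distribˡ-+ a c n ⟩
    (a % n + c % n) % n      ≡⟨ cong₂ (λ x y → (x + y) % n) a≈b c≈d ⟩
    (b % n + d % n) % n      ≡⟨ %-distribˡ-+ b d n ⟨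
    (b + d) % n              ∎)
    where open ≡-Reasoning

  *-cong : ∀ {a b c d} → a ≈ b → c ≈ d → a * c ≈ b * d
  *-cong {a} {b} {c} {d} (mk≈ a≈b) (mk≈ c≈d) = mk≈ (begin
    (a * c) % n              ≡⟨ %-distribˡ-* a c n ⟩
    (a % n * (c % n)) % n    ≡⟨ cong₂ (λ x y → (x * y) % n) a≈b c≈d ⟩
    (b % n * (d % n)) % n    ≡⟨ %-distribˡ-* b d n ⟨
    (b * d) % n              ∎)
    where open ≡-Reasoning

  %-≈ : ∀ a → a % n ≈ a
  %-≈ a = mk≈ (m%n%n≡m%n a n)

  ∣⇒≈0 : ∀ {a} → n ∣ a → a ≈ 0
  ∣⇒≈0 {a} n∣a = mk≈ (trans (n∣m⇒m%n≡0 a n n∣a) (sym (m*n%n≡0 0 n)))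

  +-cancelʳ-≈ : ∀ {a b} c → a + c ≈ b + c → a ≈ b
  +-cancelʳ-≈ {a} {b} c a+c≈b+c = begin
    a                        ≈⟨ mk≈ ([m+kn]%n≡m%n a c n) ⟨
    a + c * n                ≡⟨ split-n a ⟩
    a + c + c * pred n       ≈⟨ +-cong a+c≈b+c (≈-refl {c * pred n}) ⟩
    b + c + c * pred n       ≡⟨ split-n b ⟨
    b + c * n                ≈⟨ mk≈ ([m+kn]%n≡m%n b c n) ⟩
    b                        ∎
    where
    open ≈-Reasoning
    split-n : ∀ x → x + c * n ≡ x + c + c * pred n
    split-n x = trans (cong (λ t → x + c * t) (sym (suc-pred n))) (lemma x c (pred n))
      where
      lemma : ∀ x c t → x + c * suc t ≡ x + c + c * t
      lemma = solve-∀

  sum≈0 : ∀ {N} (f : Fin N → ℕ) → (∀ k → f k ≈ 0) → sum f ≈ 0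
  sum≈0 {zero}  f f≈0 = ≈-refl
  sum≈0 {suc N} f f≈0 = +-cong (f≈0 _) (sum≈0 (λ k → f (Fin.suc k)) (λ k → f≈0 (Fin.suc k)))

  ∑<-ends-≈ : ∀ N (f : ℕ → ℕ) → (∀ k → 0 < k → k < suc N → f k ≈ 0) →
              ∑< (suc (suc N)) f ≈ f 0 + f (suc N)
  ∑<-ends-≈ N f inner≈0 = begin
    f 0 + sum t                      ≡⟨ cong (f 0 +_) (sum-init-last t) ⟩
    f 0 + (sum (init t) + last t)    ≈⟨ +-cong (≈-refl {f 0}) (+-cong (sum≈0 (init t) init≈0) (≈-refl {last t})) ⟩
    f 0 + f (suc (toℕ (fromℕ N)))    ≡⟨ cong (λ i → f 0 + f (suc i)) (toℕ-fromℕ N) ⟩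
    f 0 + f (suc N)                  ∎
    where
    open ≈-Reasoning
    t : Fin (suc N) → ℕ
    t k = f (suc (toℕ k))
    init≈0 : ∀ k → t (inject₁ k) ≈ 0
    init≈0 k = inner≈0 _ z<s (s<s (subst (_< N) (sym (toℕ-inject₁ k)) (toℕ<n k)))

prime∣n!⇒p≤n : ∀ {p n} → Prime p → p ∣ n ! → p ≤ n
prime∣n!⇒p≤n {n = zero}  pr p∣1 = contradiction (subst Prime (∣1⇒≡1 p∣1) pr) ¬prime[1]
prime∣n!⇒p≤n {n = suc n} pr p∣[1+n]! =
  [ ∣⇒≤ , (λ p∣n! → m≤n⇒m≤1+n (prime∣n!⇒p≤n pr p∣n!)) ]′ (euclidsLemma (suc n) (n !) pr p∣[1+n]!)

prime∣pCk : ∀ {p k} → Prime p → 0 < k → k < p → p ∣ p C k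
prime∣pCk {p@(suc p-1)} {k@(suc k-1)} pr _ k<p =
  [ id , ⊥-elim ∘ p∤k!*[p∸k]! ]′ (euclidsLemma (p C k) (k ! * (p ∸ k) !) pr p∣pCk*k!*[p∸k]!)
  where
  instance _ = k !* (p ∸ k) !≢0
  p!≡pCk*k!*[p∸k]! : p ! ≡ (p C k) * (k ! * (p ∸ k) !)
  p!≡pCk*k!*[p∸k]! = sym (trans (cong (_* (k ! * (p ∸ k) !)) (nCk≡n!/k![n-k]! (<⇒≤ k<p)))
                               (m/n*n≡m (k![n∸k]!∣n! (<⇒≤ k<p))))
  p∣pCk*k!*[p∸k]! : p ∣ (p C k) * (k ! * (p ∸ k) !)
  p∣pCk*k!*[p∸k]! = subst (p ∣_) p!≡pCk*k!*[p∸k]! (m∣m*n (p-1 !))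
  p∤k!*[p∸k]! : ¬ p ∣ k ! * (p ∸ k) !
  p∤k!*[p∸k]! p∣ = [ (λ p∣k! → <⇒≱ k<p (prime∣n!⇒p≤n pr p∣k!))
                   , (λ p∣[p∸k]! → <⇒≱ (s≤s (m∸n≤m p-1 k-1)) (prime∣n!⇒p≤n pr p∣[p∸k]!)) ]′
                   (euclidsLemma (k !) ((p ∸ k) !) pr p∣)

binomial-+1 : ∀ x n → (x + 1) ^ n ≡ ∑< (suc n) (λ k → (n C k) * x ^ k)
binomial-+1 x n = begin
  (x + 1) ^ n                           ≡⟨ ^ₛ≡^ (x + 1) n ⟨
  (x + 1) ^ₛ n                          ≡⟨ Binomial.theorem n x 1 ⟩
  Binomial.binomialExpansion x 1 n      ≡⟨ sum-cong-≗ term≡ ⟩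
  ∑< (suc n) (λ k → (n C k) * x ^ k)    ∎
  where
  open ≡-Reasoning
  ^ₛ≡^ : ∀ y i → y ^ₛ i ≡ y ^ i
  ^ₛ≡^ y zero    = refl
  ^ₛ≡^ y (suc i) = cong (y *_) (^ₛ≡^ y i)
  ×≡* : ∀ i y → i ×ₘ y ≡ i * y
  ×≡* zero    y = refl
  ×≡* (suc i) y = cong (y +_) (×≡* i y)
  term≡ : ∀ k → Binomial.binomialTerm x 1 n k ≡ (n C toℕ k) * x ^ toℕ k
  term≡ k = trans (×≡* (n C toℕ k) _) (cong ((n C toℕ k) *_) (begin
    x ^ₛ toℕ k * 1 ^ₛ (n ∸ toℕ k)  ≡⟨ cong₂ _*_ (^ₛ≡^ x (toℕ k)) (trans (^ₛ≡^ 1 (n ∸ toℕ k)) (^-zeroˡ (n ∸ toℕ k))) ⟩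
    x ^ toℕ k * 1                  ≡⟨ *-identityʳ (x ^ toℕ k) ⟩
    x ^ toℕ k                      ∎))

module ModuloPrime {n} (pr : Prime (suc n)) where

  p : ℕ
  p = suc n

  open Congruence p

  frobenius : ∀ x → (x + 1) ^ p ≈ x ^ p + 1
  frobenius x = begin
    (x + 1) ^ p                          ≡⟨ binomial-+1 x p ⟩
    ∑< (suc p) (λ k → (p C k) * x ^ k)   ≈⟨ ∑<-ends-≈ n (λ k → (p C k) * x ^ k) inner≈0 ⟩
    1 + (p C p) * x ^ p                  ≡⟨ cong (λ c → 1 + c * x ^ p) (nCn≡1 p) ⟩
    1 + (x ^ p + 0)                      ≡⟨ cong (1 +_) (+-identityʳ (x ^ p)) ⟩
    1 + x ^ p                            ≡⟨ +-comm 1 (x ^ p) ⟩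
    x ^ p + 1                            ∎
    where
    open ≈-Reasoning
    inner≈0 : ∀ k → 0 < k → k < p → (p C k) * x ^ k ≈ 0
    inner≈0 k 0<k k<p = ∣⇒≈0 (∣m⇒∣m*n (x ^ k) (prime∣pCk pr 0<k k<p))

  fermat : ∀ x → x ^ p ≈ x
  fermat zero    = ≈-refl
  fermat (suc x) = begin
    suc x ^ p     ≡⟨ cong (_^ p) (+-comm 1 x) ⟩
    (x + 1) ^ p   ≈⟨ frobenius x ⟩
    x ^ p + 1     ≈⟨ +-cong (fermat x) (≈-refl {1}) ⟩
    x + 1         ≡⟨ +-comm x 1 ⟩
    suc x         ∎
    where open ≈-Reasoning

  1+j*c≈0-solvable : ∀ {c} → suc c < p → ∃ λ j → j < p × 1 + j * suc c ≈ 0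
  1+j*c≈0-solvable {c} 1+c<p with coprime-Bézout (prime⇒coprime pr 1+c<p)
  ... | Bézout.+- x y 1+y*c≡x*p = y % p , m%n<n y p , (begin
    1 + y % p * suc c      ≈⟨ +-cong (≈-refl {1}) (*-cong (%-≈ y) (≈-refl {suc c})) ⟩
    1 + y * suc c          ≡⟨ 1+y*c≡x*p ⟩
    x * p                  ≈⟨ ∣⇒≈0 (n∣m*n x) ⟩
    0                      ∎)
    where open ≈-Reasoning
  ... | Bézout.-+ x y 1+x*p≡y*c = n * y % p , m%n<n (n * y) p , (begin
    1 + n * y % p * suc c  ≈⟨ +-cong (≈-refl {1}) (*-cong (%-≈ (n * y)) (≈-refl {suc c})) ⟩
    1 + n * y * suc c      ≡⟨ cong suc (*-assoc n y (suc c)) ⟩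
    1 + n * (y * suc c)    ≈⟨ +-cong (≈-refl {1}) (*-cong (≈-refl {n}) y*c≈1) ⟩
    1 + n * 1              ≡⟨ cong suc (*-identityʳ n) ⟩
    p                      ≈⟨ ∣⇒≈0 ∣-refl ⟩
    0                      ∎)
    where
    open ≈-Reasoning
    y*c≈1 : y * suc c ≈ 1
    y*c≈1 = ≈-trans (≡⇒≈ (sym 1+x*p≡y*c)) (mk≈ ([m+kn]%n≡m%n 1 x p))

module Array (m : ℕ) where

  E : ℕ → ℕ → ℕ
  E zero    j       = 1
  E (suc i) zero    = 1
  E (suc i) (suc j) = E i (suc j) + m * E i j + E (suc i) j

  E[i,0]≡1 : ∀ i → E i 0 ≡ 1
  E[i,0]≡1 zero    = refl
  E[i,0]≡1 (suc i) = refl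

  E-sym : ∀ i j → E i j ≡ E j i
  E-sym zero    zero    = refl
  E-sym zero    (suc j) = refl
  E-sym (suc i) zero    = refl
  E-sym (suc i) (suc j) = begin
    E i (suc j) + m * E i j + E (suc i) j  ≡⟨ cong₂ (λ x y → x + m * y + E (suc i) j) (E-sym i (suc j)) (E-sym i j) ⟩
    E (suc j) i + m * E j i + E (suc i) j  ≡⟨ cong (E (suc j) i + m * E j i +_) (E-sym (suc i) j) ⟩
    E (suc j) i + m * E j i + E j (suc i)  ≡⟨ swap (E (suc j) i) (m * E j i) (E j (suc i)) ⟩
    E j (suc i) + m * E j i + E (suc j) i  ∎
    where
    open ≡-Reasoning
    swap : ∀ a b c → a + b + c ≡ c + b + a
    swap = solve-∀

  E[1,j] : ∀ j → E 1 j ≡ 1 + j * suc m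
  E[1,j] zero    = refl
  E[1,j] (suc j) = trans (cong (1 + m * 1 +_) (E[1,j] j)) (lemma m j)
    where
    lemma : ∀ m j → 1 + m * 1 + (1 + j * suc m) ≡ 1 + suc j * suc m
    lemma = solve-∀

  term : ℕ → ℕ → ℕ → ℕ
  term i j k = (i C k) * (j C k) * suc m ^ k

  shifted-term : ℕ → ℕ → ℕ → ℕ
  shifted-term i j zero    = 0
  shifted-term i j (suc k) = suc m * term i j k

  -- Pascal's rule in both indices, arranged so that no subtraction occurs.
  term-pascal : ∀ i j k → term (suc i) (suc j) k + suc m * term i j k
                        ≡ term i (suc j) k + m * term i j k + term (suc i) j k + shifted-term i j k
  term-pascal i j zero    = lemma m
    where
    lemma : ∀ m → 1 + suc m * 1 ≡ 1 + m * 1 + 1 + 0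
    lemma = solve-∀
  term-pascal i j (suc k) rewrite sym (nCk+nC[k+1]≡[n+1]C[k+1] i k) | sym (nCk+nC[k+1]≡[n+1]C[k+1] j k) =
    lemma (i C k) (i C suc k) (j C k) (j C suc k) m (suc m ^ k)
    where
    lemma : ∀ a a′ b b′ m y →
      (a + a′) * (b + b′) * (suc m * y) + suc m * (a′ * b′ * (suc m * y))
        ≡ a′ * (b + b′) * (suc m * y) + m * (a′ * b′ * (suc m * y)) + (a + a′) * b′ * (suc m * y) + suc m * (a * b * y)
    lemma = solve-∀

  ∑<-shifted-term : ∀ N i j → suc i < N → ∑< N (shifted-term i j) ≡ suc m * ∑< N (term i j)
  ∑<-shifted-term (suc N) i j (s<s i<N) = begin
    ∑< N (λ k → suc m * term i j k)  ≡⟨ ∑<-* N (suc m) (term i j) ⟩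
    suc m * ∑< N (term i j)          ≡⟨ cong (suc m *_) (∑<-drop-last N (term i j) term-vanishes) ⟨
    suc m * ∑< (suc N) (term i j)    ∎
    where
    open ≡-Reasoning
    term-vanishes : term i j N ≡ 0
    term-vanishes = cong (λ c → c * (j C N) * suc m ^ N) (k>n⇒nCk≡0 i<N)

  -- Any length N > i works, so all four sums in the recurrence can share one length.
  E≡∑<term : ∀ N i j → i < N → E i j ≡ ∑< N (term i j)
  E≡∑<term (suc N) zero    j       _ = sym (cong suc (sum-replicate-zero N))
  E≡∑<term (suc N) (suc i) zero    _ =
    sym (cong suc (trans (sum-cong-≗ {N} (term[1+i,0,1+k]≡0 ∘ toℕ)) (sum-replicate-zero N)))
    where
    term[1+i,0,1+k]≡0 : ∀ k → term (suc i) 0 (suc k) ≡ 0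
    term[1+i,0,1+k]≡0 k = cong (_* suc m ^ suc k) (*-zeroʳ (suc i C suc k))
  E≡∑<term N       (suc i) (suc j) 1+i<N = sym (+-cancelʳ-≡ (suc m * ∑< N (term i j)) _ _ (begin
    ∑< N (term (suc i) (suc j)) + suc m * ∑< N (term i j)
      ≡⟨ cong (∑< N (term (suc i) (suc j)) +_) (∑<-* N (suc m) (term i j)) ⟨
    ∑< N (term (suc i) (suc j)) + ∑< N (λ k → suc m * term i j k)
      ≡⟨ ∑<-+ N (term (suc i) (suc j)) (λ k → suc m * term i j k) ⟨
    ∑< N (λ k → term (suc i) (suc j) k + suc m * term i j k)
      ≡⟨ sum-cong-≗ {N} (term-pascal i j ∘ toℕ) ⟩
    ∑< N (λ k → term i (suc j) k + m * term i j k + term (suc i) j k + shifted-term i j k)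
      ≡⟨ ∑<-linear N m (term i (suc j)) (term i j) (term (suc i) j) (shifted-term i j) ⟩
    ∑< N (term i (suc j)) + m * ∑< N (term i j) + ∑< N (term (suc i) j) + ∑< N (shifted-term i j)
      ≡⟨ cong₂ _+_ (cong₂ _+_ (cong₂ (λ x y → x + m * y) (E≡∑<term N i (suc j) i<N) (E≡∑<term N i j i<N))
                              (E≡∑<term N (suc i) j 1+i<N))
                   (sym (∑<-shifted-term N i j 1+i<N)) ⟨
    E (suc i) (suc j) + suc m * ∑< N (term i j)   ∎))
    where
    open ≡-Reasoning
    i<N = <-trans (n<1+n i) 1+i<N

module Lucas {n} (pr : Prime (suc n)) (m : ℕ) where

  p : ℕ
  p = suc n

  open Congruence p
  open ModuloPrime pr using (fermat)
  open Array m

  E[p,s] : ∀ s → E p s ≈ 1 + (s C p) * suc m ^ p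
  E[p,s] s = begin
    E p s                             ≡⟨ E≡∑<term (suc p) p s (n<1+n p) ⟩
    ∑< (suc p) (term p s)             ≈⟨ ∑<-ends-≈ n (term p s) inner≈0 ⟩
    1 + (p C p) * (s C p) * suc m ^ p ≡⟨ cong (λ c → 1 + c * (s C p) * suc m ^ p) (nCn≡1 p) ⟩
    1 + 1 * (s C p) * suc m ^ p       ≡⟨ cong (λ c → 1 + c * suc m ^ p) (*-identityˡ (s C p)) ⟩
    1 + (s C p) * suc m ^ p           ∎
    where
    open ≈-Reasoning
    inner≈0 : ∀ k → 0 < k → k < p → term p s k ≈ 0
    inner≈0 k 0<k k<p = ∣⇒≈0 (∣m⇒∣m*n _ (∣m⇒∣m*n _ (prime∣pCk pr 0<k k<p)))

  E[p,s]≈1 : ∀ {s} → s < p → E p s ≈ 1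
  E[p,s]≈1 {s} s<p = ≈-trans (E[p,s] s) (≡⇒≈ (cong (λ c → 1 + c * suc m ^ p) (k>n⇒nCk≡0 s<p)))

  E[p,p]≈2+m : E p p ≈ 2 + m
  E[p,p]≈2+m = begin
    E p p                       ≈⟨ E[p,s] p ⟩
    1 + (p C p) * suc m ^ p     ≡⟨ cong (λ c → 1 + c * suc m ^ p) (nCn≡1 p) ⟩
    1 + 1 * suc m ^ p           ≡⟨ cong (1 +_) (*-identityˡ (suc m ^ p)) ⟩
    1 + suc m ^ p               ≈⟨ +-cong (≈-refl {1}) (fermat (suc m)) ⟩
    2 + m                       ∎
    where open ≈-Reasoning

  E[n,1+s]+m*E[n,s]≈0 : ∀ {s} → suc s < p → E n (suc s) + m * E n s ≈ 0
  E[n,1+s]+m*E[n,s]≈0 {s} 1+s<p = +-cancelʳ-≈ (E p s) (begin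
    E n (suc s) + m * E n s + E p s   ≡⟨⟩
    E p (suc s)                       ≈⟨ E[p,s]≈1 1+s<p ⟩
    1                                 ≈⟨ E[p,s]≈1 (<-trans (n<1+n s) 1+s<p) ⟨
    E p s                             ∎)
    where open ≈-Reasoning

  E[1+r,n]+m*E[r,n]≈0 : ∀ {r} → suc r < p → E (suc r) n + m * E r n ≈ 0
  E[1+r,n]+m*E[r,n]≈0 {r} 1+r<p =
    subst (_≈ 0) (cong₂ (λ x y → x + m * y) (E-sym n (suc r)) (E-sym n r)) (E[n,1+s]+m*E[n,s]≈0 1+r<p)

  m*E[n,n]≈m : m * E n n ≈ m
  m*E[n,n]≈m = +-cancelʳ-≈ 2 (begin
    m * E n n + 2                     ≡⟨ lemma (m * E n n) ⟩
    1 + m * E n n + 1                 ≈⟨ +-cong (+-cong (≈-sym E[n,p]≈1) (≈-refl {m * E n n})) (≈-sym (E[p,s]≈1 (n<1+n n))) ⟩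
    E n p + m * E n n + E p n         ≡⟨⟩
    E p p                             ≈⟨ E[p,p]≈2+m ⟩
    2 + m                             ≡⟨ +-comm 2 m ⟩
    m + 2                             ∎)
    where
    open ≈-Reasoning
    lemma : ∀ x → x + 2 ≡ 1 + x + 1
    lemma = solve-∀
    E[n,p]≈1 : E n p ≈ 1
    E[n,p]≈1 = subst (_≈ 1) (E-sym p n) (E[p,s]≈1 (n<1+n n))

  recurrence-cong : ∀ {a₁ a₂ a₃ b₁ b₂ b₃} → a₁ ≈ b₁ → a₂ ≈ b₂ → a₃ ≈ b₃ → a₁ + m * a₂ + a₃ ≈ b₁ + m * b₂ + b₃
  recurrence-cong a₁≈b₁ a₂≈b₂ a₃≈b₃ = +-cong (+-cong a₁≈b₁ (*-cong (≈-refl {m}) a₂≈b₂)) a₃≈b₃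

  interior-step : ∀ r s e → E r (suc s) * e + m * (E r s * e) + E (suc r) s * e ≈ E (suc r) (suc s) * e
  interior-step r s e = ≡⇒≈ (lemma (E r (suc s)) (E r s) (E (suc r) s) m e)
    where
    lemma : ∀ a b c m e → a * e + m * (b * e) + c * e ≡ (a + m * b + c) * e
    lemma = solve-∀

  row-carry-step : ∀ {s} → suc s < p → ∀ e e′ → E n (suc s) * e + m * (E n s * e) + E 0 s * e′ ≈ E 0 (suc s) * e′
  row-carry-step {s} 1+s<p e e′ = begin
    E n (suc s) * e + m * (E n s * e) + 1 * e′  ≡⟨ lemma (E n (suc s)) (E n s) m e e′ ⟩
    (E n (suc s) + m * E n s) * e + 1 * e′      ≈⟨ +-cong (*-cong (E[n,1+s]+m*E[n,s]≈0 1+s<p) (≈-refl {e})) (≈-refl {1 * e′}) ⟩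
    1 * e′                                      ∎
    where
    open ≈-Reasoning
    lemma : ∀ a b m e e′ → a * e + m * (b * e) + 1 * e′ ≡ (a + m * b) * e + 1 * e′
    lemma = solve-∀

  column-carry-step : ∀ {r} → suc r < p → ∀ e e′ → E r 0 * e′ + m * (E r n * e) + E (suc r) n * e ≈ E (suc r) 0 * e′
  column-carry-step {r} 1+r<p e e′ = begin
    E r 0 * e′ + m * (E r n * e) + E (suc r) n * e  ≡⟨ cong (λ x → x * e′ + m * (E r n * e) + E (suc r) n * e) (E[i,0]≡1 r) ⟩
    1 * e′ + m * (E r n * e) + E (suc r) n * e      ≡⟨ lemma (E r n) (E (suc r) n) m e e′ ⟩
    1 * e′ + (E (suc r) n + m * E r n) * e          ≈⟨ +-cong (≈-refl {1 * e′}) (*-cong (E[1+r,n]+m*E[r,n]≈0 1+r<p) (≈-refl {e})) ⟩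
    1 * e′ + 0                                      ≡⟨ +-identityʳ (1 * e′) ⟩
    1 * e′                                          ∎
    where
    open ≈-Reasoning
    lemma : ∀ b c m e e′ → 1 * e′ + m * (b * e) + c * e ≡ 1 * e′ + (c + m * b) * e
    lemma = solve-∀

  corner-step : ∀ i j → E n 0 * E i (suc j) + m * (E n n * E i j) + E 0 n * E (suc i) j ≈ E 0 0 * E (suc i) (suc j)
  corner-step i j = begin
    E n 0 * E i (suc j) + m * (E n n * E i j) + 1 * E (suc i) j
      ≡⟨ cong (λ x → x * E i (suc j) + m * (E n n * E i j) + 1 * E (suc i) j) (E[i,0]≡1 n) ⟩
    1 * E i (suc j) + m * (E n n * E i j) + 1 * E (suc i) j
      ≡⟨ lemma (E i (suc j)) (E n n) (E i j) (E (suc i) j) m ⟩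
    E i (suc j) + m * E n n * E i j + E (suc i) j
      ≈⟨ +-cong (+-cong (≈-refl {E i (suc j)}) (*-cong m*E[n,n]≈m (≈-refl {E i j}))) (≈-refl {E (suc i) j}) ⟩
    E i (suc j) + m * E i j + E (suc i) j
      ≡⟨ +-identityʳ _ ⟨
    1 * E (suc i) (suc j)   ∎
    where
    open ≈-Reasoning
    lemma : ∀ a x b c m → 1 * a + m * (x * b) + 1 * c ≡ a + m * x * b + c
    lemma = solve-∀

  -- Unfolds the recurrence at (r + i p, s + j p): for r, s > 0 all three neighbours lie in the
  -- same block, otherwise some come from the neighbouring block with top digit n = p - 1.
  E-digits : ∀ i r j s → r < p → s < p → E (r + i * p) (s + j * p) ≈ E r s * E i j
  E-digits zero    zero    j       zero    _    _    = ≈-refl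
  E-digits (suc i) zero    zero    zero    _    _    = ≈-refl
  E-digits (suc i) zero    (suc j) zero    _    _    =
    ≈-trans (recurrence-cong (E-digits i n (suc j) zero (n<1+n n) z<s) (E-digits i n j n (n<1+n n) (n<1+n n))
                             (E-digits (suc i) zero j n z<s (n<1+n n)))
            (corner-step i j)
  E-digits zero    zero    j       (suc s) _    _    = ≈-refl
  E-digits (suc i) zero    j       (suc s) _    1+s<p =
    ≈-trans (recurrence-cong (E-digits i n j (suc s) (n<1+n n) 1+s<p) (E-digits i n j s (n<1+n n) s<p)
                             (E-digits (suc i) zero j s z<s s<p))
            (row-carry-step 1+s<p (E i j) (E (suc i) j))
    where s<p = <-trans (n<1+n s) 1+s<p
  E-digits i       (suc r) zero    zero    _    _    = ≡⇒≈ (sym (trans (+-identityʳ (E i 0)) (E[i,0]≡1 i)))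
  E-digits i       (suc r) (suc j) zero    1+r<p _   =
    ≈-trans (recurrence-cong (E-digits i r (suc j) zero r<p z<s) (E-digits i r j n r<p (n<1+n n))
                             (E-digits i (suc r) j n 1+r<p (n<1+n n)))
            (column-carry-step 1+r<p (E i j) (E i (suc j)))
    where r<p = <-trans (n<1+n r) 1+r<p
  E-digits i       (suc r) j       (suc s) 1+r<p 1+s<p =
    ≈-trans (recurrence-cong (E-digits i r j (suc s) r<p 1+s<p) (E-digits i r j s r<p s<p)
                             (E-digits i (suc r) j s 1+r<p s<p))
            (interior-step r s (E i j))
    where
    r<p = <-trans (n<1+n r) 1+r<p
    s<p = <-trans (n<1+n s) 1+s<p

  lucas : ∀ x y → E x y ≈ E (x % p) (y % p) * E (x / p) (y / p)
  lucas x y = begin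
    E x y                                         ≡⟨ cong₂ E (m≡m%n+[m/n]*n x p) (m≡m%n+[m/n]*n y p) ⟩
    E (x % p + x / p * p) (y % p + y / p * p)     ≈⟨ E-digits (x / p) (x % p) (y / p) (y % p) (m%n<n x p) (m%n<n y p) ⟩
    E (x % p) (y % p) * E (x / p) (y / p)         ∎
    where open ≈-Reasoning

≡0⇔not[≡ᵇ0]≡false : ∀ r → (r ≡ 0) ⇔ (not (r ≡ᵇ 0) ≡ false)
≡0⇔not[≡ᵇ0]≡false zero    = mk⇔ (λ _ → refl) (λ _ → refl)
≡0⇔not[≡ᵇ0]≡false (suc r) = mk⇔ (λ ()) (λ ())

module ZeroPattern {n} (pr : Prime (suc n)) (m : ℕ) where

  open Lucas pr m using (p; recurrence-cong; lucas)
  open Congruence p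
  open ModuloPrime pr using (1+j*c≈0-solvable)
  open Array m

  1<p : 1 < p
  1<p = nonTrivial⇒n>1 p {{prime⇒nonTrivial pr}}

  entryM≡E%p : ∀ i j → entryM p m i j ≡ E i j % p
  entryM≡E%p zero    j       = refl
  entryM≡E%p (suc i) zero    = refl
  entryM≡E%p (suc i) (suc j)
    rewrite entryM≡E%p i (suc j) | entryM≡E%p i j | entryM≡E%p (suc i) j =
    %-≡ (recurrence-cong (%-≈ (E i (suc j))) (%-≈ (E i j)) (%-≈ (E (suc i) j)))

  nonzero? : ℕ → Bool
  nonzero? x = not (x % p ≡ᵇ 0)

  nonzero?-cong : ∀ {x y} → x ≈ y → nonzero? x ≡ nonzero? y
  nonzero?-cong x≈y = cong (λ r → not (r ≡ᵇ 0)) (%-≡ x≈y)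

  %≡1+r⇒∤ : ∀ {x r} → x % p ≡ suc r → ¬ p ∣ x
  %≡1+r⇒∤ {x} x%p≡1+r p∣x = case trans (sym x%p≡1+r) (n∣m⇒m%n≡0 x p p∣x) of λ ()

  nonzero?-* : ∀ x y → nonzero? (x * y) ≡ nonzero? x ∧ nonzero? y
  nonzero?-* x y with x % p in x%p | y % p in y%p | (x * y) % p in xy%p
  ... | zero  | _     | zero  = refl
  ... | zero  | _     | suc _ =
    contradiction (trans (sym xy%p) (%-≡ (*-cong (mk≈ {x} {0} x%p) (≈-refl {y})))) λ ()
  ... | suc _ | zero  | zero  = refl
  ... | suc _ | zero  | suc _ =
    contradiction (trans (sym xy%p) (trans (%-≡ (*-cong (≈-refl {x}) (mk≈ {y} {0} y%p))) (cong (_% p) (*-zeroʳ x))))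
                  λ ()
  ... | suc _ | suc _ | zero  =
    ⊥-elim ([ %≡1+r⇒∤ x%p , %≡1+r⇒∤ y%p ]′ (euclidsLemma x y pr (m%n≡0⇒n∣m (x * y) p xy%p)))
  ... | suc _ | suc _ | suc _ = refl

  support : BinMat p
  support a b = nonzero? (entryM p m (toℕ a) (toℕ b))

  support≡nonzero?∘E : ∀ a b → support a b ≡ nonzero? (E (toℕ a) (toℕ b))
  support≡nonzero?∘E a b =
    trans (cong nonzero? (entryM≡E%p (toℕ a) (toℕ b))) (nonzero?-cong (%-≈ (E (toℕ a) (toℕ b))))

  kronPow-support : ∀ d i j → i < p ^ d → j < p ^ d → kronPow p support d i j ≡ nonzero? (E i j)
  kronPow-support zero    zero    zero    _         _ = cong (λ r → not (r ≡ᵇ 0)) (sym (m<n⇒m%n≡m 1<p))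
  kronPow-support zero    (suc i) j       (s<s ())  _
  kronPow-support zero    zero    (suc j) _         (s<s ())
  kronPow-support (suc d) i       j       i<p^[1+d] j<p^[1+d] = begin
    kronPow p support d (i / p) (j / p) ∧ support (i mod p) (j mod p)
      ≡⟨ cong₂ _∧_ (kronPow-support d (i / p) (j / p) (quotient-bound i<p^[1+d]) (quotient-bound j<p^[1+d]))
                   (support-mod i j) ⟩
    nonzero? (E (i / p) (j / p)) ∧ nonzero? (E (i % p) (j % p))
      ≡⟨ ∧-comm (nonzero? (E (i / p) (j / p))) (nonzero? (E (i % p) (j % p))) ⟩
    nonzero? (E (i % p) (j % p)) ∧ nonzero? (E (i / p) (j / p))
      ≡⟨ nonzero?-* (E (i % p) (j % p)) (E (i / p) (j / p)) ⟨
    nonzero? (E (i % p) (j % p) * E (i / p) (j / p))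
      ≡⟨ nonzero?-cong (lucas i j) ⟨
    nonzero? (E i j)   ∎
    where
    open ≡-Reasoning
    quotient-bound : ∀ {x} → x < p ^ suc d → x / p < p ^ d
    quotient-bound {x} x<p^[1+d] = m<n*o⇒m/o<n (subst (x <_) (*-comm p (p ^ d)) x<p^[1+d])
    support-mod : ∀ x y → support (x mod p) (y mod p) ≡ nonzero? (E (x % p) (y % p))
    support-mod x y = trans (support≡nonzero?∘E (x mod p) (y mod p))
                            (cong₂ (λ a b → nonzero? (E a b)) (toℕ-fromℕ< (m%n<n x p)) (toℕ-fromℕ< (m%n<n y p)))

  entryM≡0⇔kronPow≡false : ∀ d i j → i < p ^ d → j < p ^ d → (entryM p m i j ≡ 0) ⇔ (kronPow p support d i j ≡ false)
  entryM≡0⇔kronPow≡false d i j i<p^d j<p^d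
    rewrite kronPow-support d i j i<p^d j<p^d | entryM≡E%p i j = ≡0⇔not[≡ᵇ0]≡false (E i j % p)

  support-has-zero : suc m < p → ∃ λ a → ∃ λ b → support a b ≡ false
  support-has-zero 1+m<p with 1+j*c≈0-solvable 1+m<p
  ... | j , j<p , 1+j*c≈0 = fromℕ< 1<p , fromℕ< j<p , (begin
    support (fromℕ< 1<p) (fromℕ< j<p)                    ≡⟨ support≡nonzero?∘E (fromℕ< 1<p) (fromℕ< j<p) ⟩
    nonzero? (E (toℕ (fromℕ< 1<p)) (toℕ (fromℕ< j<p)))   ≡⟨ cong₂ (λ a b → nonzero? (E a b)) (toℕ-fromℕ< 1<p) (toℕ-fromℕ< j<p) ⟩
    nonzero? (E 1 j)                                     ≡⟨ cong nonzero? (E[1,j] j) ⟩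
    nonzero? (1 + j * suc m)                             ≡⟨ nonzero?-cong 1+j*c≈0 ⟩
    false                                                ∎)
    where open ≡-Reasoning

  entryM≡1 : suc m ≡ p → ∀ i j → entryM p m i j ≡ 1
  entryM≡1 _     zero    j       = m<n⇒m%n≡m 1<p
  entryM≡1 _     (suc i) zero    = m<n⇒m%n≡m 1<p
  entryM≡1 1+m≡p (suc i) (suc j)
    rewrite entryM≡1 1+m≡p i (suc j) | entryM≡1 1+m≡p i j | entryM≡1 1+m≡p (suc i) j = begin
    (1 + m * 1 + 1) % p   ≡⟨ cong (_% p) (trans (lemma m) (cong suc 1+m≡p)) ⟩
    (1 + p) % p           ≡⟨ [m+n]%n≡m%n 1 p ⟩
    1 % p                 ≡⟨ m<n⇒m%n≡m 1<p ⟩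
    1                     ∎
    where
    open ≡-Reasoning
    lemma : ∀ m → 1 + m * 1 + 1 ≡ suc (suc m)
    lemma = solve-∀

corollary3p10 : (p : ℕ) (pr : Prime p) (m : ℕ) → m < p →
    (suc m ≢ p →
      Σ (BinMat p {{prime⇒nonZero pr}}) λ D →
        (∃ λ i → ∃ λ j → D i j ≡ false) ×
        (∃ λ i → ∃ λ j → ∃ λ i′ → ∃ λ j′ →
          ((i , j) ≢ (i′ , j′)) × (D i j ≡ true) × (D i′ j′ ≡ true)) ×
        ((d : ℕ) → d ≥ 1 → (i j : ℕ) → i < p ^ d → j < p ^ d →
          (entryM p {{prime⇒nonZero pr}} m i j ≡ 0)
            ⇔ (kronPow p {{prime⇒nonZero pr}} D d i j ≡ false)))
    × (suc m ≡ p →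
      (d : ℕ) → d ≥ 1 → (i j : ℕ) → i < p ^ d → j < p ^ d →
        ¬ (entryM p {{prime⇒nonZero pr}} m i j ≡ 0))
corollary3p10 zero          pr = contradiction pr ¬prime[0]
corollary3p10 (suc zero)    pr = contradiction pr ¬prime[1]
corollary3p10 (suc (suc k)) pr m m<p =
  (λ 1+m≢p → support , support-has-zero (≤∧≢⇒< m<p 1+m≢p) , (0F , 0F , 0F , 1F , (λ ()) , refl , refl) ,
             λ d _ → entryM≡0⇔kronPow≡false d) ,
  (λ 1+m≡p d _ i j _ _ entryM≡0 → case trans (sym (entryM≡1 1+m≡p i j)) entryM≡0 of λ ())
  where open ZeroPattern pr m
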